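{- Let $U\le G$, $k\in\{1,\dots,n-1\}$, and let $C$ be a $U$-symmetric social preference correspondence. Then the induced $k$-multiwinner social choice correspondence $C_k$ is $U$-consistent.
   Context: Let $n,h\ge 2$ be integers, $N=\{1,\dots,n\}$. $S_m$ is the symmetric group on $\{1,\dots,m\}$ with product $(\sigma\tau)(x)=\sigma(\tau(x))$. $\mathbf L(N)$ is the set of linear orders on $N$; a linear order $q$ with $q(1)\succ\dots\succ q(n)$ is identified with the permutation $r\mapsto q(r)$ in $S_n$. Let $\rho_0(r)=n-r+1$, $\Omega=\{id,\rho_0\}\le S_n$. $\mathcal P=\mathbf L(N)^h$. $G=S_h\times S_n\times\Omega$; $p^{(\varphi,\psi,\rho)}$ is the profile with $i$-th component $\psi p_{\varphi^{ -1}(i)}\rho$. A social preference correspondence (SPC) assigns to each $p$ a subset $C(p)\subseteq\mathbf L(N)$; it is $U$-symmetric if $C(p^{(\varphi,\psi,\rho)})=\{\psi q\rho:q\in C(p)\}$ for all $p$ and $(\varphi,\psi,\rho)\in U$. A $k$-multiwinner social choice correspondence assigns to each $p$ a set $C(p)$ of $k$-subsets of $N$; it is $U$-consistent if for all $p$ and $(\varphi,\psi,\rho)\in U$: $C(p^{(\varphi,\psi,\rho)})=\psi C(p)$ if $\rho=id$, and $C(p^{(\varphi,\psi,\rho)})\ne\psi C(p)$ if $\rho=\rho_0$ and $|C(p)|=1$, where $\psi\mathbb W=\{\psi(W):W\in\mathbb W\}$. The $k$-SCC induced by an SPC $C$ is $C_k(p)=\{\{q(1),\dots,q(k)\}:q\in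 C(p)\}$. -}

module Defs where

open import Data.Nat using (ℕ; zero; suc)
open import Data.Fin using (Fin)
open import Data.Fin.Subset using (Subset; ⁅_⁆; _∪_) renaming (⊥ to ∅)
open import Data.Fin.Permutation using (Permutation′; _⟨$⟩ʳ_; _⟨$⟩ˡ_; _∘ₚ_; flip) renaming (id to idₚ)
open import Data.Vec using (Vec; []; _∷_; lookup; tabulate; map; reverse)
open import Data.Product using (Σ; ∃; _×_; _,_)
open import Function.Bundles using (_⇔_)
open import Function.Definitions using (Injective)
open import Relation.Binary.PropositionalEquality using (_≡_)
open import Relation.Nullary using (¬_)

-- Alternatives N = {1..n} are represented by Fin n (element i ↦ i+1).
-- A linear order q is represented by the vector (q(1), …, q(n)) of
-- alternatives, best first; it is a linear order iff it is injective.
Order : ℕ → Set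
Order n = Vec (Fin n) n

IsLinOrd : ∀ {n} → Order n → Set
IsLinOrd q = Injective _≡_ _≡_ (lookup q)

Profile : ℕ → ℕ → Set
Profile n h = Vec (Order n) h

IsProfile : ∀ {n h} → Profile n h → Set
IsProfile {h = h} p = (i : Fin h) → IsLinOrd (lookup p i)

-- Ω = {id, ρ₀}, ρ₀(r) = n - r + 1.
data Ω : Set where
  idΩ ρ₀ : Ω

_·Ω_ : Ω → Ω → Ω
idΩ ·Ω ρ = ρ
ρ₀ ·Ω idΩ = ρ₀
ρ₀ ·Ω ρ₀ = idΩ

record G (n h : ℕ) : Set where
  constructor ⟨_,_,_⟩
  field
    φ : Permutation′ h
    ψ : Permutation′ n
    ρ : Ω

open G public

-- group structure of G; (σ τ)(x) = σ(τ(x)), i.e. σ·τ = τ ∘ₚ σ in stdlib's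
-- diagrammatic composition.
εG : ∀ {n h} → G n h
εG = ⟨ idₚ , idₚ , idΩ ⟩

_·G_ : ∀ {n h} → G n h → G n h → G n h
⟨ φ₁ , ψ₁ , ρ₁ ⟩ ·G ⟨ φ₂ , ψ₂ , ρ₂ ⟩ = ⟨ φ₂ ∘ₚ φ₁ , ψ₂ ∘ₚ ψ₁ , ρ₁ ·Ω ρ₂ ⟩

invΩ : Ω → Ω
invΩ ρ = ρ

_⁻¹G : ∀ {n h} → G n h → G n h
⟨ φ , ψ , ρ ⟩ ⁻¹G = ⟨ flip φ , flip ψ , invΩ ρ ⟩

record IsSubgroup {n h : ℕ} (U : G n h → Set) : Set where
  field
    ε-closed : U εG
    ·-closed : ∀ {g g′} → U g → U g′ → U (g ·G g′)
    ⁻¹-closed : ∀ {g} → U g → U (g ⁻¹G)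

_·ρ_ : ∀ {n} → Order n → Ω → Order n
q ·ρ idΩ = q
q ·ρ ρ₀ = reverse q

actOrd : ∀ {n} → Permutation′ n → Ω → Order n → Order n
actOrd ψ ρ q = map (ψ ⟨$⟩ʳ_) (q ·ρ ρ)

actProf : ∀ {n h} → G n h → Profile n h → Profile n h
actProf ⟨ φ , ψ , ρ ⟩ p = tabulate (λ i → actOrd ψ ρ (lookup p (φ ⟨$⟩ˡ i)))

SPC : ℕ → ℕ → Set₁
SPC n h = Profile n h → Order n → Set

IsSPC : ∀ {n h} → SPC n h → Set
IsSPC {n} {h} C = (p : Profile n h) → IsProfile p → (q : Order n) → C p q → IsLinOrd q

_≐_ : ∀ {A : Set} → (A → Set) → (A → Set) → Set
P ≐ Q = ∀ x → P x ⇔ Q x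

Symmetric : ∀ {n h} → (G n h → Set) → SPC n h → Set
Symmetric {n} {h} U C =
  (p : Profile n h) → IsProfile p → (g : G n h) → U g →
  C (actProf g p) ≐ (λ q → ∃ λ q′ → C p q′ × q ≡ actOrd (ψ g) (ρ g) q′)

KSCC : ℕ → ℕ → Set₁
KSCC n h = Profile n h → Subset n → Set

top : ∀ {n m} → ℕ → Vec (Fin n) m → Subset n
top zero q = ∅
top (suc k) [] = ∅
top (suc k) (x ∷ q) = ⁅ x ⁆ ∪ top k q

imageSub : ∀ {n} → Permutation′ n → Subset n → Subset n
imageSub ψ W = tabulate (λ x → lookup W (ψ ⟨$⟩ˡ x))

imageFam : ∀ {n} → Permutation′ n → (Subset n → Set) → (Subset n → Set)
imageFam ψ 𝕎 W′ = ∃ λ W → 𝕎 W × W′ ≡ imageSub ψ W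

induced : ∀ {n h} → ℕ → SPC n h → KSCC n h
induced k C p W = ∃ λ q → C p q × W ≡ top k q

Singleton : ∀ {n} → (Subset n → Set) → Set
Singleton 𝕎 = ∃ λ W → 𝕎 W × (∀ W′ → 𝕎 W′ → W′ ≡ W)

Consistent : ∀ {n h} → (G n h → Set) → KSCC n h → Set
Consistent {n} {h} U C =
  (p : Profile n h) → IsProfile p → (g : G n h) → U g →
  (ρ g ≡ idΩ → C (actProf g p) ≐ imageFam (ψ g) (C p)) ×
  (ρ g ≡ ρ₀ → Singleton (C p) → ¬ (C (actProf g p) ≐ imageFam (ψ g) (C p)))

module Submission where

-- Write top k q = {q(1), …, q(k)} for the top-k set of an order.
-- Two facts about top-k sets carry the whole argument:
--   (1) top-k sets commute with relabelling alternatives: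
--       top k (ψ q) = ψ(top k q) for every permutation ψ of N;
--   (2) reversing a linear order changes its top-k set when 1 ≤ k < n:
--       q(1) lies in top k q but not in top k (q ρ₀) = {q(n), …, q(n-k+1)}.
-- Consistency for g = (φ, ψ, id) then follows from U-symmetry of C and (1):
-- the winning sets at p^g are the tops of the orders ψ q with q ∈ C(p), i.e.
-- the sets ψ(top k q).  For g = (φ, ψ, ρ₀) and C_k(p) = {top k q₀}, symmetry
-- puts ψ q₀ ρ₀ into C(p^g); if C_k(p^g) were ψ C_k(p), then by (1) and the
-- injectivity of W ↦ ψ(W) we would get top k (q₀ ρ₀) = top k q₀, against (2).

open import Defs
open import Data.Nat using (ℕ; _≤_; _<_; zero; suc; s≤s; z≤n)
open import Data.Fin using (Fin) renaming (zero to fzero; suc to fsuc)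
open import Data.Fin.Subset using (⁅_⁆; _∈_; _∉_)
open import Data.Fin.Subset.Properties using (∉⊥; x∈⁅y⁆⇔x≡y; x∈p∪q⁻; x∈p∪q⁺; ⊆-antisym)
open import Data.Fin.Permutation using (Permutation′; _⟨$⟩ʳ_; _⟨$⟩ˡ_; inverseˡ; inverseʳ)
open import Data.Vec using (Vec; []; _∷_; map; reverse; _∷ʳ_)
open import Data.Vec.Properties using ([]=⇒lookup; lookup⇒[]=; lookup∘tabulate; reverse-∷)
open import Data.Vec.Relation.Unary.All using (All; []; _∷_)
open import Data.Vec.Relation.Unary.All.Properties using (lookup⁻)
open import Data.Product using (∃; _×_; _,_)
open import Data.Sum using (_⊎_; inj₁; inj₂; [_,_]′)
open import Data.Sum.Function.Propositional using (_⊎-⇔_)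
open import Data.Empty using (⊥-elim)
open import Function.Base using (_∘_)
open import Function.Bundles using (_⇔_; mk⇔; Equivalence)
open import Function.Properties.Equivalence using () renaming (sym to ⇔-sym; trans to ⇔-trans)
open import Relation.Binary.PropositionalEquality using (_≡_; _≢_; refl; sym; trans; cong; subst)
open Relation.Binary.PropositionalEquality.≡-Reasoning
open import Relation.Nullary using (¬_)

open Equivalence using (to; from)

module _ {n : ℕ} (ψ : Permutation′ n) where

  relabel-adjoint : ∀ {x y : Fin n} → y ≡ ψ ⟨$⟩ʳ x ⇔ ψ ⟨$⟩ˡ y ≡ x
  relabel-adjoint = mk⇔ (λ { refl → inverseˡ ψ }) (λ { refl → sym (inverseʳ ψ) })

  ∈-imageSub : ∀ {y W} → y ∈ imageSub ψ W ⇔ ψ ⟨$⟩ˡ y ∈ W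
  ∈-imageSub {y} {W} = mk⇔
    (λ y∈ψW → lookup⇒[]= _ W (trans (sym (lookup∘tabulate _ y)) ([]=⇒lookup y∈ψW)))
    (λ ψ⁻¹y∈W → lookup⇒[]= y _ (trans (lookup∘tabulate _ y) ([]=⇒lookup ψ⁻¹y∈W)))

  imageSub-injective : ∀ {A B} → imageSub ψ A ≡ imageSub ψ B → A ≡ B
  imageSub-injective eq = ⊆-antisym (cancel eq) (cancel (sym eq))
    where
    cancel : ∀ {A B} → imageSub ψ A ≡ imageSub ψ B → ∀ {x} → x ∈ A → x ∈ B
    cancel {A} {B} eq {x} x∈A =
      subst (_∈ B) (inverseˡ ψ)
        (to ∈-imageSub (subst (ψ ⟨$⟩ʳ x ∈_) eq
          (from ∈-imageSub (subst (_∈ A) (sym (inverseˡ ψ)) x∈A))))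

∈-top-∷ : ∀ {n m} k (x : Fin n) (v : Vec (Fin n) m) {y} →
          y ∈ top (suc k) (x ∷ v) ⇔ (y ≡ x ⊎ y ∈ top k v)
∈-top-∷ k x v = mk⇔
  (λ y∈ → [ inj₁ ∘ to x∈⁅y⁆⇔x≡y , inj₂ ]′ (x∈p∪q⁻ ⁅ x ⁆ (top k v) y∈))
  (λ y∈ → x∈p∪q⁺ ([ inj₁ ∘ from x∈⁅y⁆⇔x≡y , inj₂ ]′ y∈))

module _ {n : ℕ} (ψ : Permutation′ n) where

  ∈-top-relabel : ∀ {m} k (v : Vec (Fin n) m) {y} →
                  y ∈ top k (map (ψ ⟨$⟩ʳ_) v) ⇔ ψ ⟨$⟩ˡ y ∈ top k v
  ∈-top-relabel zero    v       = mk⇔ (⊥-elim ∘ ∉⊥) (⊥-elim ∘ ∉⊥)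
  ∈-top-relabel (suc k) []      = mk⇔ (⊥-elim ∘ ∉⊥) (⊥-elim ∘ ∉⊥)
  ∈-top-relabel (suc k) (x ∷ v) =
    ⇔-trans (∈-top-∷ k (ψ ⟨$⟩ʳ x) (map (ψ ⟨$⟩ʳ_) v))
      (⇔-trans (relabel-adjoint ψ ⊎-⇔ ∈-top-relabel k v) (⇔-sym (∈-top-∷ k x v)))

  top-relabel : ∀ {m} k (v : Vec (Fin n) m) → top k (map (ψ ⟨$⟩ʳ_) v) ≡ imageSub ψ (top k v)
  top-relabel k v = ⊆-antisym
    (from (∈-imageSub ψ) ∘ to (∈-top-relabel k v))
    (from (∈-top-relabel k v) ∘ to (∈-imageSub ψ))

fresh∉top-∷ʳ : ∀ {n m k} {y z : Fin n} {ys : Vec (Fin n) m} →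
               k ≤ m → All (y ≢_) ys → y ∉ top k (ys ∷ʳ z)
fresh∉top-∷ʳ {k = zero}  _ _ = ∉⊥
fresh∉top-∷ʳ {k = suc k} {z = z} {ys = x ∷ ys} (s≤s k≤m) (y≢x ∷ y-fresh) y∈ =
  [ y≢x , fresh∉top-∷ʳ k≤m y-fresh ]′ (to (∈-top-∷ k x (ys ∷ʳ z)) y∈)

All-∷ʳ : ∀ {A : Set} {P : A → Set} {m} {xs : Vec A m} {x} → All P xs → P x → All P (xs ∷ʳ x)
All-∷ʳ []         px = px ∷ []
All-∷ʳ (py ∷ pxs) px = py ∷ All-∷ʳ pxs px

All-reverse : ∀ {A : Set} {P : A → Set} {m} {xs : Vec A m} → All P xs → All P (reverse xs)
All-reverse []                          = []
All-reverse {P = P} {xs = x ∷ xs} (px ∷ pxs) =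
  subst (All P) (sym (reverse-∷ x xs)) (All-∷ʳ (All-reverse pxs) px)

-- (2) For 1 ≤ k < n, a linear order and its reversal have different top-k
-- sets: the best alternative q(1) is among the k best but not the k worst.
top-reverse≢top : ∀ {n k} (q : Order n) → IsLinOrd q → 1 ≤ k → k < n →
                  top k (reverse q) ≢ top k q
top-reverse≢top {k = suc k} (x ∷ xs) q-inj (s≤s z≤n) (s≤s k<m) eq =
  head∉bottom (subst (x ∈_) (sym eq) head∈top)
  where
  head∈top : x ∈ top (suc k) (x ∷ xs)
  head∈top = from (∈-top-∷ k x xs) (inj₁ refl)

  x-fresh : All (x ≢_) (reverse xs)
  x-fresh = All-reverse {xs = xs} (lookup⁻ (λ i x≡xsᵢ → head≢tail (q-inj {fzero} {fsuc i} x≡xsᵢ)))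
    where
    head≢tail : ∀ {i} → fzero ≢ fsuc i
    head≢tail ()

  head∉bottom : x ∉ top (suc k) (reverse (x ∷ xs))
  head∉bottom = subst (λ v → x ∉ top (suc k) v) (sym (reverse-∷ x xs)) (fresh∉top-∷ʳ k<m x-fresh)

module _ {n h : ℕ} (k : ℕ) (C : SPC n h) where

  induced-relabel : ∀ {p p′} (ψ : Permutation′ n) →
    C p′ ≐ (λ q → ∃ λ q′ → C p q′ × q ≡ map (ψ ⟨$⟩ʳ_) q′) →
    induced k C p′ ≐ imageFam ψ (induced k C p)
  induced-relabel {p} {p′} ψ C-relabel W = mk⇔ winner→ winner←
    where
    winner→ : induced k C p′ W → imageFam ψ (induced k C p) W
    winner→ (q , q∈ , W≡top) with to (C-relabel q) q∈
    ... | q′ , q′∈ , refl = top k q′ , (q′ , q′∈ , refl) , trans W≡top (top-relabel ψ k q′)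

    winner← : imageFam ψ (induced k C p) W → induced k C p′ W
    winner← (_ , (q′ , q′∈ , refl) , refl) =
      map (ψ ⟨$⟩ʳ_) q′ , from (C-relabel _) (q′ , q′∈ , refl) , sym (top-relabel ψ k q′)

  induced-reversal : ∀ {p p′} (ψ : Permutation′ n) → 1 ≤ k → k < n →
    (∀ {q} → C p q → IsLinOrd q) →
    (∀ {q} → C p q → C p′ (map (ψ ⟨$⟩ʳ_) (reverse q))) →
    Singleton (induced k C p) → ¬ (induced k C p′ ≐ imageFam ψ (induced k C p))
  induced-reversal ψ 1≤k k<n C-linear C-reversed (_ , (q₀ , q₀∈ , _) , unique) equal
    with to (equal _) (_ , C-reversed q₀∈ , refl)
  ... | W , W∈ , top≡ψW =
    top-reverse≢top q₀ (C-linear q₀∈) 1≤k k<n (imageSub-injective ψ (begin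
      imageSub ψ (top k (reverse q₀))         ≡⟨ sym (top-relabel ψ k (reverse q₀)) ⟩
      top k (map (ψ ⟨$⟩ʳ_) (reverse q₀))     ≡⟨ top≡ψW ⟩
      imageSub ψ W                            ≡⟨ cong (imageSub ψ) W≡top ⟩
      imageSub ψ (top k q₀)                   ∎))
    where
    W≡top : W ≡ top k q₀
    W≡top = trans (unique W W∈) (sym (unique (top k q₀) (q₀ , q₀∈ , refl)))

proposition4 : (n h : ℕ) → 2 ≤ n → 2 ≤ h →
    (U : G n h → Set) → IsSubgroup U →
    (k : ℕ) → 1 ≤ k → k < n →
    (C : SPC n h) → IsSPC C → Symmetric U C →
    Consistent U (induced k C)
proposition4 _ _ _ _ _ _ k 1≤k k<n C C-spc C-sym p p-prof ⟨ φ , ψ , idΩ ⟩ g∈U =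
  (λ _ → induced-relabel k C ψ (C-sym p p-prof ⟨ φ , ψ , idΩ ⟩ g∈U)) , λ ()
proposition4 _ _ _ _ _ _ k 1≤k k<n C C-spc C-sym p p-prof ⟨ φ , ψ , ρ₀ ⟩ g∈U =
  (λ ()) , λ _ → induced-reversal k C ψ 1≤k k<n (C-spc p p-prof _)
    (λ q∈ → from (C-sym p p-prof ⟨ φ , ψ , ρ₀ ⟩ g∈U _) (_ , q∈ , refl))
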